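{- Let $n\ge 2$ and let $p=p_1\ldots p_n\in S_n$ with $mg(p)=k$. If $1\le i<j\le n$ satisfy $d_p(i,j)=k$, then $|span_p(i,j)|=k-2$.
   Context: For $p=p_1\ldots p_n\in S_n$ (one-line notation), define $d_p(i,j)=|i-j|+|p_i-p_j|$ and the minimum gap $mg(p)=\min\{d_p(i,j):1\le i<j\le n\}$. For $1\le i<j\le n$, $span_p(i,j)$ is the set of indices of entries lying strictly between $p_i$ and $p_j$ horizontally or vertically: if $p_i<p_j$, $span_p(i,j)=\{t: i<t<j \text{ or } p_i<p_t<p_j\}$, and if $p_i>p_j$, $span_p(i,j)=\{t: i<t<j \text{ or } p_j<p_t<p_i\}$. -}

module Defs where

open import Data.Nat using (ℕ; _<_; _≤_; _<?_; ∣_-_∣; _+_; _⊓_; _⊔_)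
open import Data.Fin using (Fin; toℕ)
open import Data.Fin.Permutation using (Permutation′; _⟨$⟩ʳ_)
open import Data.List using (List; length; filter; allFin)
open import Data.Product using (_×_; ∃-syntax)
open import Data.Sum using (_⊎_)
open import Relation.Binary.PropositionalEquality using (_≡_)
open import Relation.Nullary using (Dec)
open import Relation.Nullary.Decidable using (_×-dec_; _⊎-dec_)

-- Indices and values are 0-based (Fin n); shifting both by 1 does not
-- change differences or betweenness.

val : ∀ {n} → Permutation′ n → Fin n → ℕ
val p i = toℕ (p ⟨$⟩ʳ i)

dist : ∀ {n} → Permutation′ n → Fin n → Fin n → ℕ
dist p i j = ∣ toℕ i - toℕ j ∣ + ∣ val p i - val p j ∣

IsMinGap : ∀ {n} → Permutation′ n → ℕ → Set
IsMinGap {n} p k =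
  (∃[ i ] ∃[ j ] (toℕ i < toℕ j × dist p i j ≡ k)) ×
  (∀ (i j : Fin n) → toℕ i < toℕ j → k ≤ dist p i j)

InSpan : ∀ {n} → Permutation′ n → Fin n → Fin n → Fin n → Set
InSpan p i j t =
  (toℕ i < toℕ t × toℕ t < toℕ j) ⊎
  ((val p i ⊓ val p j) < val p t × val p t < (val p i ⊔ val p j))

inSpan? : ∀ {n} (p : Permutation′ n) (i j t : Fin n) → Dec (InSpan p i j t)
inSpan? p i j t =
  ((toℕ i <? toℕ t) ×-dec (toℕ t <? toℕ j)) ⊎-dec
  (((val p i ⊓ val p j) <? val p t) ×-dec (val p t <? (val p i ⊔ val p j)))

-- span_p(i,j) as a list of indices (each index occurs at most once)
span : ∀ {n} → Permutation′ n → Fin n → Fin n → List (Fin n)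
span {n} p i j = filter (inSpan? p i j) (allFin n)

-- A point strictly between p_i and p_j in both coordinates would be strictly
-- closer to p_i than p_j is, contradicting the minimality of d_p(i,j).  Hence
-- span_p(i,j) is the disjoint union of the j - i - 1 indices strictly between
-- i and j and the |p_i - p_j| - 1 indices whose values lie strictly between
-- p_i and p_j, and these sizes add up to d_p(i,j) - 2.
module Submission where

open import Defs
open import Data.Nat using (ℕ; zero; suc; _≤_; _<_; _∸_; _+_; _⊓_; _⊔_; ∣_-_∣; _<?_; s≤s; s≤s⁻¹)
open import Data.Nat.Properties
open import Data.Fin using (Fin; zero; suc; toℕ)
open import Data.Fin.Properties using (toℕ-injective; toℕ<n)
open import Data.Fin.Permutation using (Permutation′; _⟨$⟩ʳ_; _⟨$⟩ˡ_; inverseˡ)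
open import Data.List using (length; filter; tabulate)
open import Data.Bool using (if_then_else_)
open import Data.Product using (_×_; _,_; proj₁)
open import Data.Sum using (inj₁; inj₂)
open import Relation.Nullary using (Dec; does; yes; no; ¬_; contradiction)
open import Relation.Nullary.Decidable using (_×-dec_; _⊎-dec_)
open import Relation.Unary using (Pred; Decidable)
open import Relation.Binary.PropositionalEquality
open import Function using (_∘_)
open import Algebra.Properties.CommutativeMonoid.Sum +-0-commutativeMonoid
  using (sum; sum-cong-≗; ∑-distrib-+; sum-permute)

χ : ∀ {a} {A : Set a} → Dec A → ℕ
χ d = if does d then 1 else 0

between? : (lo hi x : ℕ) → Dec (lo < x × x < hi)
between? lo hi x = (lo <? x) ×-dec (x <? hi)

length-filter-tabulate : ∀ {a p} {A : Set a} {P : Pred A p} (P? : Decidable P) {n} (f : Fin n → A) →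
  length (filter P? (tabulate f)) ≡ sum (χ ∘ P? ∘ f)
length-filter-tabulate P? {zero} f = refl
length-filter-tabulate P? {suc n} f with P? (f zero)
... | yes _ = cong suc (length-filter-tabulate P? (f ∘ suc))
... | no _ = length-filter-tabulate P? (f ∘ suc)

χ-⊎-dec : ∀ {a b} {A : Set a} {B : Set b} (A? : Dec A) (B? : Dec B) → ¬ (A × B) →
  χ (A? ⊎-dec B?) ≡ χ A? + χ B?
χ-⊎-dec (yes a) (yes b) ¬a×b = contradiction (a , b) ¬a×b
χ-⊎-dec (yes _) (no _) _ = refl
χ-⊎-dec (no _) (yes _) _ = refl
χ-⊎-dec (no _) (no _) _ = refl

count-below : ∀ n hi → sum {n} (λ t → χ (toℕ t <? hi)) ≡ hi ⊓ n
count-below zero hi = sym (⊓-zeroʳ hi)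
count-below (suc n) zero = count-below n zero
count-below (suc n) (suc hi) = cong suc (count-below n hi)

χ-below-+-χ-between : ∀ {lo hi} → lo < hi → ∀ x →
  χ (x <? suc lo) + χ (between? lo hi x) ≡ χ (x <? hi)
χ-below-+-χ-between {lo} {hi} lo<hi x = split (x <? suc lo) (lo <? x) (x <? hi)
  where
  split : (x≤lo? : Dec (x < suc lo)) (lo<x? : Dec (lo < x)) (x<hi? : Dec (x < hi)) →
    χ x≤lo? + χ (lo<x? ×-dec x<hi?) ≡ χ x<hi?
  split (yes x≤lo) (yes lo<x) _ = contradiction (s≤s⁻¹ x≤lo) (<⇒≱ lo<x)
  split (yes _) (no _) (yes _) = refl
  split (yes x≤lo) (no _) (no x≮hi) = contradiction (≤-<-trans (s≤s⁻¹ x≤lo) lo<hi) x≮hi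
  split (no _) (yes _) (yes _) = refl
  split (no _) (yes _) (no _) = refl
  split (no x≰lo) (no lo≮x) _ = contradiction (s≤s (≮⇒≥ lo≮x)) x≰lo

count-between : ∀ {n lo hi} → lo < hi → hi ≤ n → sum {n} (χ ∘ between? lo hi ∘ toℕ) ≡ hi ∸ suc lo
count-between {n} {lo} {hi} lo<hi hi≤n = begin
  between                    ≡⟨ m+n∸m≡n below between ⟨
  below + between ∸ below    ≡⟨ cong₂ _∸_ below+between≡hi below≡suc-lo ⟩
  hi ∸ suc lo                ∎
  where
  open ≡-Reasoning
  below between : ℕ
  below = sum {n} (λ t → χ (toℕ t <? suc lo))
  between = sum {n} (χ ∘ between? lo hi ∘ toℕ)

  below≡suc-lo : below ≡ suc lo
  below≡suc-lo = trans (count-below n (suc lo)) (m≤n⇒m⊓n≡m (≤-trans lo<hi hi≤n))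

  below+between≡hi : below + between ≡ hi
  below+between≡hi = begin
    below + between                             ≡⟨ ∑-distrib-+ {n} _ _ ⟨
    sum {n} (λ t → χ (toℕ t <? suc lo) + χ (between? lo hi (toℕ t)))   ≡⟨ sum-cong-≗ {n} (χ-below-+-χ-between lo<hi ∘ toℕ) ⟩
    sum {n} (λ t → χ (toℕ t <? hi))             ≡⟨ count-below n hi ⟩
    hi ⊓ n                                ≡⟨ m≤n⇒m⊓n≡m hi≤n ⟩
    hi                                    ∎

m⊓n<m⊔n : ∀ {m n} → m ≢ n → m ⊓ n < m ⊔ n
m⊓n<m⊔n {m} {n} m≢n with ≤-total m n
... | inj₁ m≤n = subst₂ _<_ (sym (m≤n⇒m⊓n≡m m≤n)) (sym (m≤n⇒m⊔n≡n m≤n)) (≤∧≢⇒< m≤n m≢n)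
... | inj₂ n≤m = subst₂ _<_ (sym (m≥n⇒m⊓n≡n n≤m)) (sym (m≥n⇒m⊔n≡m n≤m)) (≤∧≢⇒< n≤m (m≢n ∘ sym))

∣m-n∣≡m⊔n∸m⊓n : ∀ m n → ∣ m - n ∣ ≡ m ⊔ n ∸ m ⊓ n
∣m-n∣≡m⊔n∸m⊓n m n with ≤-total m n
... | inj₁ m≤n = trans (m≤n⇒∣m-n∣≡n∸m m≤n) (sym (cong₂ _∸_ (m≤n⇒m⊔n≡n m≤n) (m≤n⇒m⊓n≡m m≤n)))
... | inj₂ n≤m = trans (m≤n⇒∣n-m∣≡n∸m n≤m) (sym (cong₂ _∸_ (m≥n⇒m⊔n≡m n≤m) (m≥n⇒m⊓n≡n n≤m)))

m⊓n<o<m⊔n⇒∣m-o∣<∣m-n∣ : ∀ m n o → m ⊓ n < o → o < m ⊔ n → ∣ m - o ∣ < ∣ m - n ∣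
m⊓n<o<m⊔n⇒∣m-o∣<∣m-n∣ m n o lo<o o<hi with ≤-total m n
... | inj₁ m≤n rewrite m≤n⇒m⊓n≡m m≤n | m≤n⇒m⊔n≡n m≤n
  | m≤n⇒∣m-n∣≡n∸m (<⇒≤ lo<o) | m≤n⇒∣m-n∣≡n∸m m≤n = ∸-monoˡ-< o<hi (<⇒≤ lo<o)
... | inj₂ n≤m rewrite m≥n⇒m⊓n≡n n≤m | m≥n⇒m⊔n≡m n≤m
  | m≤n⇒∣n-m∣≡n∸m (<⇒≤ o<hi) | m≤n⇒∣n-m∣≡n∸m n≤m = ∸-monoʳ-< lo<o (<⇒≤ o<hi)

suc[n∸suc[m]]≡n∸m : ∀ {m n} → m < n → suc (n ∸ suc m) ≡ n ∸ m
suc[n∸suc[m]]≡n∸m m<n = sym (+-∸-assoc 1 m<n)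

module _ {n} (p : Permutation′ n) where

  val-injective : ∀ {i j} → val p i ≡ val p j → i ≡ j
  val-injective {i} {j} pᵢ≡pⱼ = begin
    i                       ≡⟨ inverseˡ p ⟨
    p ⟨$⟩ˡ (p ⟨$⟩ʳ i)        ≡⟨ cong (p ⟨$⟩ˡ_) (toℕ-injective pᵢ≡pⱼ) ⟩
    p ⟨$⟩ˡ (p ⟨$⟩ʳ j)        ≡⟨ inverseˡ p ⟩
    j                       ∎
    where open ≡-Reasoning

  count-values-between : ∀ {lo hi} → lo < hi → hi ≤ n → sum (χ ∘ between? lo hi ∘ val p) ≡ hi ∸ suc lo
  count-values-between {lo} {hi} lo<hi hi≤n =
    trans (sym (sum-permute (χ ∘ between? lo hi ∘ toℕ) p)) (count-between lo<hi hi≤n)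

  BetweenInBothCoordinates : Fin n → Fin n → Fin n → Set
  BetweenInBothCoordinates i j t =
    (toℕ i < toℕ t × toℕ t < toℕ j) × (val p i ⊓ val p j < val p t × val p t < val p i ⊔ val p j)

  dist-between : ∀ {i j t} → BetweenInBothCoordinates i j t → dist p i t < dist p i j
  dist-between {i} {j} {t} ((i<t , t<j) , (lo<t , t<hi)) =
    +-mono-< (m⊓n<o<m⊔n⇒∣m-o∣<∣m-n∣ (toℕ i) (toℕ j) (toℕ t) i⊓j<t t<i⊔j)
             (m⊓n<o<m⊔n⇒∣m-o∣<∣m-n∣ (val p i) (val p j) (val p t) lo<t t<hi)
    where
    i≤j : toℕ i ≤ toℕ j
    i≤j = <⇒≤ (<-trans i<t t<j)
    i⊓j<t : toℕ i ⊓ toℕ j < toℕ t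
    i⊓j<t = subst (_< toℕ t) (sym (m≤n⇒m⊓n≡m i≤j)) i<t
    t<i⊔j : toℕ t < toℕ i ⊔ toℕ j
    t<i⊔j = subst (toℕ t <_) (sym (m≤n⇒m⊔n≡n i≤j)) t<j

  2+length-span : ∀ {i j} → toℕ i < toℕ j → (∀ t → ¬ BetweenInBothCoordinates i j t) →
    2 + length (span p i j) ≡ dist p i j
  2+length-span {i} {j} i<j disjoint = begin
    2 + length (span p i j)
      ≡⟨ cong (2 +_) (length-filter-tabulate (inSpan? p i j) (λ t → t)) ⟩
    2 + sum {n} (χ ∘ inSpan? p i j)
      ≡⟨ cong (2 +_) (sum-cong-≗ {n} λ t → χ-⊎-dec (between? ti tj (toℕ t)) (between? lo hi (val p t)) (disjoint t)) ⟩
    2 + sum {n} (λ t → χ (between? ti tj (toℕ t)) + χ (between? lo hi (val p t)))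
      ≡⟨ cong (2 +_) (∑-distrib-+ (χ ∘ between? ti tj ∘ toℕ) (χ ∘ between? lo hi ∘ val p)) ⟩
    2 + (sum {n} (χ ∘ between? ti tj ∘ toℕ) + sum {n} (χ ∘ between? lo hi ∘ val p))
      ≡⟨ cong (2 +_) (cong₂ _+_ (count-between i<j (<⇒≤ (toℕ<n j))) (count-values-between lo<hi hi≤n)) ⟩
    2 + ((tj ∸ suc ti) + (hi ∸ suc lo))
      ≡⟨ cong suc (+-suc _ _) ⟨
    suc (tj ∸ suc ti) + suc (hi ∸ suc lo)
      ≡⟨ cong₂ _+_ (suc[n∸suc[m]]≡n∸m i<j) (suc[n∸suc[m]]≡n∸m lo<hi) ⟩
    (tj ∸ ti) + (hi ∸ lo)
      ≡⟨ cong₂ _+_ (m≤n⇒∣m-n∣≡n∸m (<⇒≤ i<j)) (∣m-n∣≡m⊔n∸m⊓n (val p i) (val p j)) ⟨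
    dist p i j
      ∎
    where
    open ≡-Reasoning
    ti tj lo hi : ℕ
    ti = toℕ i
    tj = toℕ j
    lo = val p i ⊓ val p j
    hi = val p i ⊔ val p j
    lo<hi : lo < hi
    lo<hi = m⊓n<m⊔n λ pᵢ≡pⱼ → <-irrefl (cong toℕ (val-injective pᵢ≡pⱼ)) i<j
    hi≤n : hi ≤ n
    hi≤n = <⇒≤ (⊔-pres-<m (toℕ<n (p ⟨$⟩ʳ i)) (toℕ<n (p ⟨$⟩ʳ j)))

lemma2 : (n : ℕ) → 2 ≤ n → (p : Permutation′ n) → (k : ℕ) → IsMinGap p k →
    (i j : Fin n) → toℕ i < toℕ j → dist p i j ≡ k →
    length (span p i j) ≡ k ∸ 2
lemma2 n _ p k (_ , k≤dist) i j i<j dist≡k =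
  cong (_∸ 2) (trans (2+length-span p i<j no-point-between) dist≡k)
  where
  no-point-between : ∀ t → ¬ BetweenInBothCoordinates p i j t
  no-point-between t between =
    <⇒≱ (subst (dist p i t <_) dist≡k (dist-between p between)) (k≤dist i t (proj₁ (proj₁ between)))
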